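{- A graph $G$ with no isolated vertices is critically $P_4$-exist if and only if $G$ is isomorphic to one of the following graphs, each built on a path with vertices $r,s,t,u$ and edges $rs,st,tu$: (1) the path plus a vertex adjacent exactly to $r,u$ (i.e. $C_5$); (2) the path plus a vertex adjacent exactly to $r,s,u$; (3) the path plus a vertex adjacent exactly to $r,s,u$ and a nonadjacent vertex adjacent exactly to $r,t,u$; (4) for some $k\ge 0$, the path plus $k$ pairwise nonadjacent vertices each adjacent exactly to $r,t$; (5) for some $k\ge 0$, the path plus $k$ pairwise nonadjacent vertices each adjacent exactly to $r,s,t,u$.
   Context: All graphs are finite and simple; $P_4$ is the path on four vertices. For an edge $e=uv$, the contraction $G/e$ is obtained by deleting $u,v$ and adding a new vertex adjacent to every vertex of $(N(u)\cup N(v))\setminus\{u,v\}$. $G$ is critically $P_4$-exist if $G$ has an induced $P_4$ but $G/e$ has none for every $e\in E(G)$. -}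

module Defs where

open import Data.Bool using (Bool; true; false; _∨_; T)
open import Data.Bool.Properties using (∨-comm)
open import Data.Nat using (ℕ)
open import Data.Fin using (Fin; zero; suc)
open import Data.Maybe using (Maybe; just; nothing)
open import Data.Sum using (_⊎_; inj₁; inj₂)
open import Data.Product using (Σ; ∃; _×_; _,_; proj₁)
open import Relation.Binary.PropositionalEquality using (_≡_; _≢_; refl)
open import Relation.Nullary using (¬_)
open import Function.Bundles using (_↔_; Inverse; _⇔_)

record Graph (V : Set) : Set where
  field
    adj    : V → V → Bool
    sym    : ∀ a b → adj a b ≡ adj b a
    irrefl : ∀ a → adj a a ≡ false
open Graph public

Adj : ∀ {V} → Graph V → V → V → Set
Adj G a b = T (adj G a b)

NoIsolated : ∀ {V} → Graph V → Set
NoIsolated {V} G = ∀ (v : V) → ∃ λ w → Adj G v w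

-- Induced P4  a - b - c - d  (distinctness of a,b,c,d follows from the
-- adjacency conditions in a simple graph).
HasInducedP4 : ∀ {V} → Graph V → Set
HasInducedP4 {V} G = Σ V λ a → Σ V λ b → Σ V λ c → Σ V λ d →
  Adj G a b × Adj G b c × Adj G c d ×
  ¬ Adj G a c × ¬ Adj G b d × ¬ Adj G a d

-- Contraction G/uv: vertex set (V ∖ {u,v}) plus a new vertex (nothing),
-- which is adjacent to every w ∉ {u,v} adjacent to u or to v.
ContrV : ∀ {V} → V → V → Set
ContrV {V} u v = Maybe (Σ V λ w → w ≢ u × w ≢ v)

contrAdj : ∀ {V} → Graph V → (u v : V) → ContrV u v → ContrV u v → Bool
contrAdj G u v nothing  nothing  = false
contrAdj G u v nothing  (just (w , _)) = adj G u w ∨ adj G v w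
contrAdj G u v (just (w , _)) nothing  = adj G u w ∨ adj G v w
contrAdj G u v (just (a , _)) (just (b , _)) = adj G a b

contract : ∀ {V} → Graph V → (u v : V) → Graph (ContrV u v)
contract G u v = record
  { adj = contrAdj G u v
  ; sym = s
  ; irrefl = i }
  where
  s : ∀ a b → contrAdj G u v a b ≡ contrAdj G u v b a
  s nothing nothing = refl
  s nothing (just _) = refl
  s (just _) nothing = refl
  s (just (a , _)) (just (b , _)) = Graph.sym G a b
  i : ∀ a → contrAdj G u v a a ≡ false
  i nothing = refl
  i (just (a , _)) = Graph.irrefl G a

CriticallyP4Exist : ∀ {V} → Graph V → Set
CriticallyP4Exist {V} G =
  HasInducedP4 G × (∀ (u v : V) → Adj G u v → ¬ HasInducedP4 (contract G u v))

_≅_ : ∀ {V W} → Graph V → Graph W → Set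
_≅_ {V} {W} G H = Σ (V ↔ W) λ f →
  ∀ a b → adj G a b ≡ adj H (Inverse.to f a) (Inverse.to f b)

-- Path r - s - t - u on Fin 4 (r = 0, s = 1, t = 2, u = 3).
pathAdj : Fin 4 → Fin 4 → Bool
pathAdj zero (suc zero) = true
pathAdj (suc zero) zero = true
pathAdj (suc zero) (suc (suc zero)) = true
pathAdj (suc (suc zero)) (suc zero) = true
pathAdj (suc (suc zero)) (suc (suc (suc zero))) = true
pathAdj (suc (suc (suc zero))) (suc (suc zero)) = true
pathAdj _ _ = false

pathAdj-sym : ∀ i j → pathAdj i j ≡ pathAdj j i
pathAdj-sym zero zero = refl
pathAdj-sym zero (suc zero) = refl
pathAdj-sym zero (suc (suc zero)) = refl
pathAdj-sym zero (suc (suc (suc zero))) = refl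
pathAdj-sym (suc zero) zero = refl
pathAdj-sym (suc zero) (suc zero) = refl
pathAdj-sym (suc zero) (suc (suc zero)) = refl
pathAdj-sym (suc zero) (suc (suc (suc zero))) = refl
pathAdj-sym (suc (suc zero)) zero = refl
pathAdj-sym (suc (suc zero)) (suc zero) = refl
pathAdj-sym (suc (suc zero)) (suc (suc zero)) = refl
pathAdj-sym (suc (suc zero)) (suc (suc (suc zero))) = refl
pathAdj-sym (suc (suc (suc zero))) zero = refl
pathAdj-sym (suc (suc (suc zero))) (suc zero) = refl
pathAdj-sym (suc (suc (suc zero))) (suc (suc zero)) = refl
pathAdj-sym (suc (suc (suc zero))) (suc (suc (suc zero))) = refl

pathAdj-irrefl : ∀ i → pathAdj i i ≡ false
pathAdj-irrefl zero = refl
pathAdj-irrefl (suc zero) = refl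
pathAdj-irrefl (suc (suc zero)) = refl
pathAdj-irrefl (suc (suc (suc zero))) = refl

pathPlusAdj : (k : ℕ) → (Fin k → Fin 4 → Bool) →
  Fin 4 ⊎ Fin k → Fin 4 ⊎ Fin k → Bool
pathPlusAdj k N (inj₁ i) (inj₁ j) = pathAdj i j
pathPlusAdj k N (inj₁ i) (inj₂ x) = N x i
pathPlusAdj k N (inj₂ x) (inj₁ i) = N x i
pathPlusAdj k N (inj₂ x) (inj₂ y) = false

PathPlus : (k : ℕ) → (Fin k → Fin 4 → Bool) → Graph (Fin 4 ⊎ Fin k)
PathPlus k N = record
  { adj = pathPlusAdj k N
  ; sym = s
  ; irrefl = i }
  where
  s : ∀ a b → pathPlusAdj k N a b ≡ pathPlusAdj k N b a
  s (inj₁ a) (inj₁ b) = pathAdj-sym a b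
  s (inj₁ a) (inj₂ b) = refl
  s (inj₂ a) (inj₁ b) = refl
  s (inj₂ a) (inj₂ b) = refl
  i : ∀ a → pathPlusAdj k N a a ≡ false
  i (inj₁ a) = pathAdj-irrefl a
  i (inj₂ a) = refl

nbr : Bool → Bool → Bool → Bool → Fin 4 → Bool
nbr r s t u zero = r
nbr r s t u (suc zero) = s
nbr r s t u (suc (suc zero)) = t
nbr r s t u (suc (suc (suc zero))) = u

family1 : Graph (Fin 4 ⊎ Fin 1)
family1 = PathPlus 1 (λ _ → nbr true false false true)

family2 : Graph (Fin 4 ⊎ Fin 1)
family2 = PathPlus 1 (λ _ → nbr true true false true)

family3nbr : Fin 2 → Fin 4 → Bool
family3nbr zero = nbr true true false true
family3nbr (suc _) = nbr true false true true

family3 : Graph (Fin 4 ⊎ Fin 2)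
family3 = PathPlus 2 family3nbr

family4 : (k : ℕ) → Graph (Fin 4 ⊎ Fin k)
family4 k = PathPlus k (λ _ → nbr true false true false)

family5 : (k : ℕ) → Graph (Fin 4 ⊎ Fin k)
family5 k = PathPlus k (λ _ → nbr true true true true)

InFamily : ∀ {V} → Graph V → Set
InFamily G =
  (G ≅ family1) ⊎ (G ≅ family2) ⊎ (G ≅ family3) ⊎
  (∃ λ k → G ≅ family4 k) ⊎ (∃ λ k → G ≅ family5 k)

-- Fix an induced P4 r s t u of G. Contracting an edge between two vertices off
-- the path keeps the path intact, so the other vertices are pairwise nonadjacent,
-- and (as G has no isolated vertices) each has a nonempty trace on the path.
-- The path plus one or two such vertices is an induced subgraph of G, so any
-- contraction of it with an induced P4 gives one of G; a finite search over
-- these small graphs leaves the traces {r,u}, {r,s,u}, {r,t,u}, {r,t}, {s,u},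
-- {r,s,t,u}, and allows two vertices only with equal traces {r,t}, {s,u} or
-- {r,s,t,u}, or with the traces {r,s,u} and {r,t,u}. Up to reversing the path,
-- these are the five families. Conversely, (1)-(3) are checked by the same
-- search; in (4) and (5) an edge meets at most one extra vertex and the other
-- extra vertices are twins, so they may be merged, which reduces k to 2.
module Submission where

open import Defs hiding (sym)
open import Data.Bool using (Bool; true; false; T; _∨_)
open import Data.Bool.Properties using (T?) renaming (_≟_ to _≟ᵇ_)
open import Data.Empty using (⊥-elim)
open import Data.Fin using (Fin; suc; _≟_; opposite; _↑ˡ_)
open import Data.Fin.Patterns using (0F; 1F; 2F; 3F)
open import Data.Fin.Permutation using (Permutation; transpose; _∘ₚ_)
import Data.Fin.Permutation.Components as PC
open import Data.Fin.Properties
  using (any?; all?; 0≢1+n; suc-injective; ↑ˡ-injective; +↔⊎; injective⇒≤; opposite-involutive)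
open import Data.Maybe using (Maybe; just; nothing)
open import Data.Nat using (ℕ; zero; suc)
open import Data.Nat.Properties using (m≤n⇒∃[o]m+o≡n)
open import Data.Product using (Σ; ∃; _×_; _,_; proj₁; proj₂)
open import Data.Sum using (_⊎_; inj₁; inj₂; [_,_]′; map₁; map₂)
open import Data.Sum.Properties using (≡-dec; inj₁-injective; inj₂-injective)
open import Data.Unit using (⊤; tt)
open import Function using (_∘_)
open import Function.Bundles using (_↔_; Inverse; Injection; _⇔_; mk⇔; mk↔ₛ′)
open import Function.Definitions using (Injective)
open import Function.Construct.Composition using (_↔-∘_)
open import Function.Construct.Identity using (↔-id)
open import Function.Construct.Symmetry using (↔-sym)
open import Function.Properties.Inverse using (↔⇒↣)
open import Relation.Binary using (DecidableEquality)
open import Relation.Binary.PropositionalEquality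
  using (_≡_; _≢_; refl; sym; trans; cong; cong₂; cong-app; subst)
open import Relation.Nullary using (¬_; Dec; yes; no; _×-dec_; _⊎-dec_; _→-dec_; ¬?)
open import Relation.Nullary.Decidable
  using (map′; True; False; toWitness; toWitnessFalse; dec-true; dec-false)
open import Relation.Unary using (Decidable)

false≡ : ∀ {b} → ¬ T b → false ≡ b
false≡ {false} _ = refl
false≡ {true} ¬t = ⊥-elim (¬t tt)

true≡ : ∀ {b} → T b → true ≡ b
true≡ {true} _ = refl

module _ {V : Set} (G : Graph V) where

  Adj-sym : ∀ {a b} → Adj G a b → Adj G b a
  Adj-sym {a} {b} = subst T (Graph.sym G a b)

  HasP4Contraction : Set
  HasP4Contraction = Σ V λ u → Σ V λ v → Adj G u v × HasInducedP4 (contract G u v)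

  critically-P4-exist : HasInducedP4 G → ¬ HasP4Contraction → CriticallyP4Exist G
  critically-P4-exist p4 ¬c = p4 , λ u v e q → ¬c (u , v , e , q)

record AdjPreserving {V W : Set} (G : Graph V) (H : Graph W) (h : V → W) : Set where
  constructor adj-preserving
  field adj-≡ : ∀ a b → adj G a b ≡ adj H (h a) (h b)
open AdjPreserving

Separates : ∀ {V W : Set} → (V → W) → V → Set
Separates h u = ∀ w → w ≢ u → h w ≢ h u

injective⇒separates : ∀ {V W : Set} {h : V → W} → Injective _≡_ _≡_ h → ∀ u → Separates h u
injective⇒separates h-inj u w w≢u = w≢u ∘ h-inj

contract-map : ∀ {V W : Set} (h : V → W) {u v} → Separates h u → Separates h v →
  ContrV u v → ContrV (h u) (h v)
contract-map h hu hv nothing                = nothing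
contract-map h hu hv (just (w , w≢u , w≢v)) = just (h w , hu w w≢u , hv w w≢v)

module _ {V W : Set} {G : Graph V} {H : Graph W} {h : V → W} (h-adj : AdjPreserving G H h) where

  map-Adj : ∀ {a b} → Adj G a b → Adj H (h a) (h b)
  map-Adj {a} {b} = subst T (adj-≡ h-adj a b)

  map-¬Adj : ∀ {a b} → ¬ Adj G a b → ¬ Adj H (h a) (h b)
  map-¬Adj {a} {b} ¬e = ¬e ∘ subst T (sym (adj-≡ h-adj a b))

  map-P4 : HasInducedP4 G → HasInducedP4 H
  map-P4 (a , b , c , d , ab , bc , cd , ac , bd , ad) =
    h a , h b , h c , h d ,
    map-Adj ab , map-Adj bc , map-Adj cd , map-¬Adj ac , map-¬Adj bd , map-¬Adj ad

  contract-map-adj : ∀ {u v} (hu : Separates h u) (hv : Separates h v) →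
    AdjPreserving (contract G u v) (contract H (h u) (h v)) (contract-map h hu hv)
  contract-map-adj {u} {v} hu hv = adj-preserving λ where
    nothing        nothing        → refl
    nothing        (just (w , _)) → cong₂ _∨_ (adj-≡ h-adj u w) (adj-≡ h-adj v w)
    (just (w , _)) nothing        → cong₂ _∨_ (adj-≡ h-adj u w) (adj-≡ h-adj v w)
    (just (a , _)) (just (b , _)) → adj-≡ h-adj a b

map-HasP4Contraction-at : ∀ {V W} {G : Graph V} {H : Graph W} {h : V → W} →
  AdjPreserving G H h → ∀ {u v} → Separates h u → Separates h v →
  Adj G u v → HasInducedP4 (contract G u v) → HasP4Contraction H
map-HasP4Contraction-at {h = h} h-adj {u} {v} hu hv e p =
  h u , h v , map-Adj h-adj e , map-P4 (contract-map-adj h-adj hu hv) p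

map-HasP4Contraction : ∀ {V W} {G : Graph V} {H : Graph W} {h : V → W} →
  AdjPreserving G H h → Injective _≡_ _≡_ h → HasP4Contraction G → HasP4Contraction H
map-HasP4Contraction h-adj h-inj (u , v , e , p) =
  map-HasP4Contraction-at h-adj (injective⇒separates h-inj u) (injective⇒separates h-inj v) e p

module _ {V W : Set} {G : Graph V} {H : Graph W} where

  ≅-sym : G ≅ H → H ≅ G
  ≅-sym (f , f-adj) = ↔-sym f , λ a b →
    sym (trans (f-adj (from a) (from b)) (cong₂ (adj H) (strictlyInverseˡ a) (strictlyInverseˡ b)))
    where open Inverse f

  ≅-trans : ∀ {X} {K : Graph X} → G ≅ H → H ≅ K → G ≅ K
  ≅-trans (f , f-adj) (g , g-adj) = g ↔-∘ f , λ a b → trans (f-adj a b) (g-adj _ _)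

  ≅⇒AdjPreserving : (G≅H : G ≅ H) → AdjPreserving G H (Inverse.to (proj₁ G≅H))
  ≅⇒AdjPreserving (_ , f-adj) = adj-preserving f-adj

  ≅⇒AdjPreserving⁻¹ : (G≅H : G ≅ H) → AdjPreserving H G (Inverse.from (proj₁ G≅H))
  ≅⇒AdjPreserving⁻¹ G≅H = adj-preserving (proj₂ (≅-sym G≅H))

  CriticallyP4Exist-≅ : G ≅ H → HasInducedP4 H → ¬ HasP4Contraction H → CriticallyP4Exist G
  CriticallyP4Exist-≅ G≅H@(f , _) p4 ¬c = critically-P4-exist G
    (map-P4 (≅⇒AdjPreserving⁻¹ G≅H) p4)
    (¬c ∘ map-HasP4Contraction (≅⇒AdjPreserving G≅H) (Injection.injective (↔⇒↣ f)))

  InFamily-≅ : G ≅ H → InFamily H → InFamily G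
  InFamily-≅ G≅H (inj₁ i) = inj₁ (≅-trans {K = family1} G≅H i)
  InFamily-≅ G≅H (inj₂ (inj₁ i)) = inj₂ (inj₁ (≅-trans {K = family2} G≅H i))
  InFamily-≅ G≅H (inj₂ (inj₂ (inj₁ i))) = inj₂ (inj₂ (inj₁ (≅-trans {K = family3} G≅H i)))
  InFamily-≅ G≅H (inj₂ (inj₂ (inj₂ (inj₁ (k , i))))) =
    inj₂ (inj₂ (inj₂ (inj₁ (k , ≅-trans {K = family4 k} G≅H i))))
  InFamily-≅ G≅H (inj₂ (inj₂ (inj₂ (inj₂ (k , i))))) =
    inj₂ (inj₂ (inj₂ (inj₂ (k , ≅-trans {K = family5 k} G≅H i))))

permutation-between : ∀ {m N} (f g : Fin m → Fin N) → Injective _≡_ _≡_ f → Injective _≡_ _≡_ g →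
  Σ (Permutation N N) λ σ → ∀ i → Inverse.from σ (g i) ≡ f i
permutation-between {zero}  f g _     _     = ↔-id _ , λ ()
permutation-between {suc m} f g f-inj g-inj = σ ∘ₚ transpose t (g 0F) , maps
  where
  rest = permutation-between (f ∘ suc) (g ∘ suc) (suc-injective ∘ f-inj) (suc-injective ∘ g-inj)
  σ = proj₁ rest
  open Inverse σ
  t = to (f 0F)
  g-suc≢t : ∀ i → g (suc i) ≢ t
  g-suc≢t i eq = 0≢1+n (sym (f-inj (trans (sym (proj₂ rest i))
                                          (trans (cong from eq) (strictlyInverseʳ (f 0F))))))
  maps : ∀ i → from (PC.transpose (g 0F) t (g i)) ≡ f i
  maps 0F rewrite dec-true (g 0F ≟ g 0F) refl = strictlyInverseʳ (f 0F)
  maps (suc i) rewrite dec-false (g (suc i) ≟ g 0F) (0≢1+n ∘ sym ∘ g-inj)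
                     | dec-false (g (suc i) ≟ t) (g-suc≢t i) = proj₂ rest i

injection-complement : ∀ {m n} (f : Fin m → Fin n) → Injective _≡_ _≡_ f →
  Σ ℕ λ k → Σ (Fin n ↔ (Fin m ⊎ Fin k)) λ φ → ∀ i → Inverse.from φ (inj₁ i) ≡ f i
injection-complement {m} f f-inj with m≤n⇒∃[o]m+o≡n (injective⇒≤ f-inj)
... | k , refl = k , +↔⊎ ↔-∘ proj₁ σ , proj₂ σ
  where σ = permutation-between f (_↑ˡ k) f-inj (↑ˡ-injective k _ _)

Searchable : Set → Set₁
Searchable A = ∀ {P : A → Set} → Decidable P → Dec (∃ P)

search-⊎ : ∀ {A B} → Searchable A → Searchable B → Searchable (A ⊎ B)
search-⊎ search-A search-B P? = map′
  (λ { (inj₁ (a , p)) → inj₁ a , p ; (inj₂ (b , p)) → inj₂ b , p })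
  (λ { (inj₁ a , p) → inj₁ (a , p) ; (inj₂ b , p) → inj₂ (b , p) })
  (search-A (P? ∘ inj₁) ⊎-dec search-B (P? ∘ inj₂))

search-Maybe : ∀ {A} → Searchable A → Searchable (Maybe A)
search-Maybe search-A P? = map′
  (λ { (inj₁ p) → nothing , p ; (inj₂ (a , p)) → just a , p })
  (λ { (nothing , p) → inj₁ p ; (just a , p) → inj₂ (a , p) })
  (P? nothing ⊎-dec search-A (P? ∘ just))

-- F/uv is the subgraph induced on the Valid vertices of F plus a vertex
-- `nothing` joined to N(u) ∪ N(v); unlike ContrV, this vertex type is searchable.
module Merge {V : Set} (F : Graph V) (u v : V) where

  mergeAdj : Maybe V → Maybe V → Bool
  mergeAdj nothing  nothing  = false
  mergeAdj nothing  (just w) = adj F u w ∨ adj F v w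
  mergeAdj (just w) nothing  = adj F u w ∨ adj F v w
  mergeAdj (just a) (just b) = adj F a b

  Valid : Maybe V → Set
  Valid nothing  = ⊤
  Valid (just w) = w ≢ u × w ≢ v

  MergeAdj : Maybe V → Maybe V → Set
  MergeAdj A B = T (mergeAdj A B)

  -- an induced P4 A B C D, with the conditions ordered so that a search can prune early
  MergedP4 : Set
  MergedP4 =
    Σ (Maybe V) λ A → Valid A ×
    Σ (Maybe V) λ B → (Valid B × MergeAdj A B) ×
    Σ (Maybe V) λ C → (Valid C × MergeAdj B C × ¬ MergeAdj A C) ×
    Σ (Maybe V) λ D → Valid D × MergeAdj C D × ¬ MergeAdj B D × ¬ MergeAdj A D

  forget : ContrV u v → Maybe V
  forget nothing        = nothing
  forget (just (w , _)) = just w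

  forget-valid : ∀ X → Valid (forget X)
  forget-valid nothing              = tt
  forget-valid (just (_ , w≢u×w≢v)) = w≢u×w≢v

  forget-adj : ∀ X Y → contrAdj F u v X Y ≡ mergeAdj (forget X) (forget Y)
  forget-adj nothing  nothing  = refl
  forget-adj nothing  (just _) = refl
  forget-adj (just _) nothing  = refl
  forget-adj (just _) (just _) = refl

  unforget : ∀ A → Valid A → ContrV u v
  unforget nothing  _     = nothing
  unforget (just w) w-val = just (w , w-val)

  unforget-adj : ∀ A B (A-val : Valid A) (B-val : Valid B) →
    mergeAdj A B ≡ contrAdj F u v (unforget A A-val) (unforget B B-val)
  unforget-adj nothing  nothing  _ _ = refl
  unforget-adj nothing  (just _) _ _ = refl
  unforget-adj (just _) nothing  _ _ = refl
  unforget-adj (just _) (just _) _ _ = refl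

  toMerged : HasInducedP4 (contract F u v) → MergedP4
  toMerged (A , B , C , D , ab , bc , cd , ac , bd , ad) =
    forget A , forget-valid A ,
    forget B , (forget-valid B , adj⁺ A B ab) ,
    forget C , (forget-valid C , adj⁺ B C bc , adj⁻ A C ac) ,
    forget D , forget-valid D , adj⁺ C D cd , adj⁻ B D bd , adj⁻ A D ad
    where
    adj⁺ : ∀ X Y → Adj (contract F u v) X Y → MergeAdj (forget X) (forget Y)
    adj⁺ X Y = subst T (forget-adj X Y)
    adj⁻ : ∀ X Y → ¬ Adj (contract F u v) X Y → ¬ MergeAdj (forget X) (forget Y)
    adj⁻ X Y ¬e = ¬e ∘ subst T (sym (forget-adj X Y))

  fromMerged : MergedP4 → HasInducedP4 (contract F u v)
  fromMerged (A , a , B , (b , ab) , C , (c , bc , ac) , D , d , cd , bd , ad) =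
    unforget A a , unforget B b , unforget C c , unforget D d ,
    adj⁺ A B a b ab , adj⁺ B C b c bc , adj⁺ C D c d cd ,
    adj⁻ A C a c ac , adj⁻ B D b d bd , adj⁻ A D a d ad
    where
    adj⁺ : ∀ X Y x y → MergeAdj X Y → Adj (contract F u v) (unforget X x) (unforget Y y)
    adj⁺ X Y x y = subst T (unforget-adj X Y x y)
    adj⁻ : ∀ X Y x y → ¬ MergeAdj X Y → ¬ Adj (contract F u v) (unforget X x) (unforget Y y)
    adj⁻ X Y x y ¬e = ¬e ∘ subst T (sym (unforget-adj X Y x y))

module _ {V : Set} (_≟V_ : DecidableEquality V) (search : Searchable V) (F : Graph V) where
  open Merge F

  valid? : ∀ u v A → Dec (Valid u v A)
  valid? u v nothing  = yes tt
  valid? u v (just w) = ¬? (w ≟V u) ×-dec ¬? (w ≟V v)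

  mergedP4? : ∀ u v → Dec (MergedP4 u v)
  mergedP4? u v =
    search′ λ A → valid? u v A ×-dec
    search′ λ B → (valid? u v B ×-dec adj? A B) ×-dec
    search′ λ C → (valid? u v C ×-dec adj? B C ×-dec ¬? (adj? A C)) ×-dec
    search′ λ D → valid? u v D ×-dec adj? C D ×-dec ¬? (adj? B D) ×-dec ¬? (adj? A D)
    where
    search′ = search-Maybe search
    adj? : ∀ A B → Dec (MergeAdj u v A B)
    adj? A B = T? (mergeAdj u v A B)

  hasP4Contraction? : Dec (HasP4Contraction F)
  hasP4Contraction? = map′
    (λ (u , v , e , m) → u , v , e , fromMerged u v m)
    (λ (u , v , e , p) → u , v , e , toMerged u v p)
    (search λ u → search λ v → T? (adj F u v) ×-dec mergedP4? u v)

hasP4Contraction?-PathPlus : ∀ k N → Dec (HasP4Contraction (PathPlus k N))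
hasP4Contraction?-PathPlus k N =
  hasP4Contraction? (≡-dec _≟_ _≟_) (search-⊎ any? any?) (PathPlus k N)

-- the implicit argument reduces to ⊤, and is then filled in, exactly when the search succeeds
contractible-by-search : ∀ {k N} {_ : True (hasP4Contraction?-PathPlus k N)} →
  HasP4Contraction (PathPlus k N)
contractible-by-search {_} {_} {found} = toWitness found

not-contractible-by-search : ∀ {k N} {_ : False (hasP4Contraction?-PathPlus k N)} →
  ¬ HasP4Contraction (PathPlus k N)
not-contractible-by-search {_} {_} {none} = toWitnessFalse none

PathPlus-P4 : ∀ {k N} → HasInducedP4 (PathPlus k N)
PathPlus-P4 = inj₁ 0F , inj₁ 1F , inj₁ 2F , inj₁ 3F , tt , tt , tt , (λ ()) , (λ ()) , (λ ())

PathPlus-cong : ∀ {k} {N M : Fin k → Fin 4 → Bool} → (∀ x i → N x i ≡ M x i) →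
  PathPlus k N ≅ PathPlus k M
PathPlus-cong N≗M = ↔-id _ , λ where
  (inj₁ i) (inj₁ j) → refl
  (inj₁ i) (inj₂ x) → N≗M x i
  (inj₂ x) (inj₁ i) → N≗M x i
  (inj₂ x) (inj₂ y) → refl

pathAdj-opposite : ∀ i j → pathAdj i j ≡ pathAdj (opposite i) (opposite j)
pathAdj-opposite = toWitness {a? = all? λ i → all? λ j →
  pathAdj i j ≟ᵇ pathAdj (opposite i) (opposite j)} tt

pathAdj-rows-injective : ∀ i j → (∀ k → pathAdj i k ≡ pathAdj j k) → i ≡ j
pathAdj-rows-injective = toWitness {a? = all? λ i → all? λ j →
  all? (λ k → pathAdj i k ≟ᵇ pathAdj j k) →-dec i ≟ j} tt

PathPlus-reverse : ∀ {k} {N : Fin k → Fin 4 → Bool} →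
  PathPlus k N ≅ PathPlus k (λ x → N x ∘ opposite)
PathPlus-reverse {k} {N} = mk↔ₛ′ flip flip flip-involutive flip-involutive , flip-adj
  where
  flip : Fin 4 ⊎ Fin k → Fin 4 ⊎ Fin k
  flip = map₁ opposite
  flip-involutive : ∀ w → flip (flip w) ≡ w
  flip-involutive (inj₁ i) = cong inj₁ (opposite-involutive i)
  flip-involutive (inj₂ x) = refl
  flip-adj : ∀ a b → pathPlusAdj k N a b ≡ pathPlusAdj k (λ x → N x ∘ opposite) (flip a) (flip b)
  flip-adj (inj₁ i) (inj₁ j) = pathAdj-opposite i j
  flip-adj (inj₁ i) (inj₂ x) = cong (N x) (sym (opposite-involutive i))
  flip-adj (inj₂ x) (inj₁ i) = cong (N x) (sym (opposite-involutive i))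
  flip-adj (inj₂ x) (inj₂ y) = refl


mark : ∀ {k} → Maybe (Fin k) → Fin k → Fin 2
mark nothing  _ = 1F
mark (just y) x with y ≟ x
... | yes _ = 0F
... | no _  = 1F

collapse : ∀ {k} → Maybe (Fin k) → Fin 4 ⊎ Fin k → Fin 4 ⊎ Fin 2
collapse marked = map₂ (mark marked)

collapse-separates-path : ∀ {k} (marked : Maybe (Fin k)) i → Separates (collapse marked) (inj₁ i)
collapse-separates-path marked i (inj₁ j) j≢i eq = j≢i (cong inj₁ (inj₁-injective eq))
collapse-separates-path marked i (inj₂ x) _   ()

collapse-separates-marked : ∀ {k} (y : Fin k) → Separates (collapse (just y)) (inj₂ y)
collapse-separates-marked y (inj₁ j) _ ()
collapse-separates-marked y (inj₂ x) x≢y eq with y ≟ x | y ≟ y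
... | yes y≡x | _      = x≢y (cong inj₂ (sym y≡x))
... | no _    | no y≢y = y≢y refl
... | no _    | yes _  with () ← inj₂-injective eq

-- with a constant neighbourhood the extra vertices are pairwise nonadjacent twins,
-- so identifying all of them except the marked one preserves adjacency
module _ (ν : Fin 4 → Bool) where

  collapse-adj : ∀ {k} marked →
    AdjPreserving (PathPlus k (λ _ → ν)) (PathPlus 2 (λ _ → ν)) (collapse marked)
  collapse-adj marked = adj-preserving λ where
    (inj₁ i) (inj₁ j) → refl
    (inj₁ i) (inj₂ x) → refl
    (inj₂ x) (inj₁ i) → refl
    (inj₂ x) (inj₂ y) → refl

  ¬HasP4Contraction-constant : ¬ HasP4Contraction (PathPlus 2 (λ _ → ν)) →
    ∀ k → ¬ HasP4Contraction (PathPlus k (λ _ → ν))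
  ¬HasP4Contraction-constant ¬c₂ k (inj₁ i , inj₁ j , e , p) = ¬c₂
    (map-HasP4Contraction-at (collapse-adj nothing)
      (collapse-separates-path nothing i) (collapse-separates-path nothing j) e p)
  ¬HasP4Contraction-constant ¬c₂ k (inj₁ i , inj₂ y , e , p) = ¬c₂
    (map-HasP4Contraction-at (collapse-adj (just y))
      (collapse-separates-path (just y) i) (collapse-separates-marked y) e p)
  ¬HasP4Contraction-constant ¬c₂ k (inj₂ x , inj₁ j , e , p) = ¬c₂
    (map-HasP4Contraction-at (collapse-adj (just x))
      (collapse-separates-marked x) (collapse-separates-path (just x) j) e p)
  ¬HasP4Contraction-constant ¬c₂ k (inj₂ x , inj₂ y , () , p)

families-critical : ∀ {V} (G : Graph V) → InFamily G → CriticallyP4Exist G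
families-critical G (inj₁ G≅) =
  CriticallyP4Exist-≅ G≅ PathPlus-P4 not-contractible-by-search
families-critical G (inj₂ (inj₁ G≅)) =
  CriticallyP4Exist-≅ G≅ PathPlus-P4 not-contractible-by-search
families-critical G (inj₂ (inj₂ (inj₁ G≅))) =
  CriticallyP4Exist-≅ G≅ PathPlus-P4 not-contractible-by-search
families-critical G (inj₂ (inj₂ (inj₂ (inj₁ (k , G≅))))) =
  CriticallyP4Exist-≅ G≅ PathPlus-P4
    (¬HasP4Contraction-constant (nbr true false true false) not-contractible-by-search k)
families-critical G (inj₂ (inj₂ (inj₂ (inj₂ (k , G≅))))) =
  CriticallyP4Exist-≅ G≅ PathPlus-P4
    (¬HasP4Contraction-constant (nbr true true true true) not-contractible-by-search k)

-- the admissible neighbourhoods on the path r s t u (that is, 0F 1F 2F 3F) of a vertex off it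
data Pattern : Set where
  ru rsu rtu rt su rstu : Pattern

neighbours : Pattern → Fin 4 → Bool
neighbours ru   = nbr true  false false true
neighbours rsu  = nbr true  true  false true
neighbours rtu  = nbr true  false true  true
neighbours rt   = nbr true  false true  false
neighbours su   = nbr false true  false true
neighbours rstu = nbr true  true  true  true

reverse : Pattern → Pattern
reverse ru   = ru
reverse rsu  = rtu
reverse rtu  = rsu
reverse rt   = su
reverse su   = rt
reverse rstu = rstu

≗-by-evaluation : {f g : Fin 4 → Bool} {_ : True (all? λ i → f i ≟ᵇ g i)} → ∀ i → f i ≡ g i
≗-by-evaluation {_} {_} {same} = toWitness same

neighbours-reverse : ∀ p i → neighbours p (opposite i) ≡ neighbours (reverse p) i
neighbours-reverse ru   = ≗-by-evaluation
neighbours-reverse rsu  = ≗-by-evaluation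
neighbours-reverse rtu  = ≗-by-evaluation
neighbours-reverse rt   = ≗-by-evaluation
neighbours-reverse su   = ≗-by-evaluation
neighbours-reverse rstu = ≗-by-evaluation

nbr-η : ∀ (ν : Fin 4 → Bool) i → nbr (ν 0F) (ν 1F) (ν 2F) (ν 3F) i ≡ ν i
nbr-η ν 0F = refl
nbr-η ν 1F = refl
nbr-η ν 2F = refl
nbr-η ν 3F = refl

data Compatible : Pattern → Pattern → Set where
  rt-rt     : Compatible rt rt
  su-su     : Compatible su su
  rstu-rstu : Compatible rstu rstu
  rsu-rtu   : Compatible rsu rtu
  rtu-rsu   : Compatible rtu rsu

reverse-compatible : ∀ {p q} → Compatible p q → Compatible (reverse p) (reverse q)
reverse-compatible rt-rt     = su-su
reverse-compatible su-su     = rt-rt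
reverse-compatible rstu-rstu = rstu-rstu
reverse-compatible rsu-rtu   = rtu-rsu
reverse-compatible rtu-rsu   = rsu-rtu

classify-trace : ∀ b₀ b₁ b₂ b₃ →
  (Σ Pattern λ p → neighbours p ≡ nbr b₀ b₁ b₂ b₃) ⊎
  (∀ i → nbr b₀ b₁ b₂ b₃ i ≡ false) ⊎
  HasP4Contraction (PathPlus 1 (λ _ → nbr b₀ b₁ b₂ b₃))
classify-trace false false false false = inj₂ (inj₁ ≗-by-evaluation)
classify-trace true  false false false = inj₂ (inj₂ contractible-by-search)
classify-trace false true  false false = inj₂ (inj₂ contractible-by-search)
classify-trace true  true  false false = inj₂ (inj₂ contractible-by-search)
classify-trace false false true  false = inj₂ (inj₂ contractible-by-search)
classify-trace true  false true  false = inj₁ (rt , refl)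
classify-trace false true  true  false = inj₂ (inj₂ contractible-by-search)
classify-trace true  true  true  false = inj₂ (inj₂ contractible-by-search)
classify-trace false false false true  = inj₂ (inj₂ contractible-by-search)
classify-trace true  false false true  = inj₁ (ru , refl)
classify-trace false true  false true  = inj₁ (su , refl)
classify-trace true  true  false true  = inj₁ (rsu , refl)
classify-trace false false true  true  = inj₂ (inj₂ contractible-by-search)
classify-trace true  false true  true  = inj₁ (rtu , refl)
classify-trace false true  true  true  = inj₂ (inj₂ contractible-by-search)
classify-trace true  true  true  true  = inj₁ (rstu , refl)

pairNeighbours : Pattern → Pattern → Fin 2 → Fin 4 → Bool
pairNeighbours p q 0F = neighbours p
pairNeighbours p q 1F = neighbours q

classify-traces : ∀ p q → Compatible p q ⊎ HasP4Contraction (PathPlus 2 (pairNeighbours p q))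
classify-traces ru   ru   = inj₂ contractible-by-search
classify-traces ru   rsu  = inj₂ contractible-by-search
classify-traces ru   rtu  = inj₂ contractible-by-search
classify-traces ru   rt   = inj₂ contractible-by-search
classify-traces ru   su   = inj₂ contractible-by-search
classify-traces ru   rstu = inj₂ contractible-by-search
classify-traces rsu  ru   = inj₂ contractible-by-search
classify-traces rsu  rsu  = inj₂ contractible-by-search
classify-traces rsu  rtu  = inj₁ rsu-rtu
classify-traces rsu  rt   = inj₂ contractible-by-search
classify-traces rsu  su   = inj₂ contractible-by-search
classify-traces rsu  rstu = inj₂ contractible-by-search
classify-traces rtu  ru   = inj₂ contractible-by-search
classify-traces rtu  rsu  = inj₁ rtu-rsu
classify-traces rtu  rtu  = inj₂ contractible-by-search
classify-traces rtu  rt   = inj₂ contractible-by-search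
classify-traces rtu  su   = inj₂ contractible-by-search
classify-traces rtu  rstu = inj₂ contractible-by-search
classify-traces rt   ru   = inj₂ contractible-by-search
classify-traces rt   rsu  = inj₂ contractible-by-search
classify-traces rt   rtu  = inj₂ contractible-by-search
classify-traces rt   rt   = inj₁ rt-rt
classify-traces rt   su   = inj₂ contractible-by-search
classify-traces rt   rstu = inj₂ contractible-by-search
classify-traces su   ru   = inj₂ contractible-by-search
classify-traces su   rsu  = inj₂ contractible-by-search
classify-traces su   rtu  = inj₂ contractible-by-search
classify-traces su   rt   = inj₂ contractible-by-search
classify-traces su   su   = inj₁ su-su
classify-traces su   rstu = inj₂ contractible-by-search
classify-traces rstu ru   = inj₂ contractible-by-search
classify-traces rstu rsu  = inj₂ contractible-by-search
classify-traces rstu rtu  = inj₂ contractible-by-search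
classify-traces rstu rt   = inj₂ contractible-by-search
classify-traces rstu su   = inj₂ contractible-by-search
classify-traces rstu rstu = inj₁ rstu-rstu

PairwiseCompatible : ∀ {k} → (Fin k → Pattern) → Set
PairwiseCompatible pat = ∀ x y → x ≢ y → Compatible (pat x) (pat y)

PathPlus-pattern-cong : ∀ {k} {pat pat′ : Fin k → Pattern} → (∀ x → pat x ≡ pat′ x) →
  PathPlus k (neighbours ∘ pat) ≅ PathPlus k (neighbours ∘ pat′)
PathPlus-pattern-cong pat≗pat′ = PathPlus-cong λ x i → cong (λ p → neighbours p i) (pat≗pat′ x)

PathPlus-pattern-reverse : ∀ {k} {pat : Fin k → Pattern} →
  PathPlus k (neighbours ∘ pat) ≅ PathPlus k (neighbours ∘ reverse ∘ pat)
PathPlus-pattern-reverse {k} {pat} =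
  ≅-trans {G = PathPlus k (neighbours ∘ pat)} {H = PathPlus k (λ x → neighbours (pat x) ∘ opposite)}
          {K = PathPlus k (neighbours ∘ reverse ∘ pat)}
  (PathPlus-reverse {N = neighbours ∘ pat}) (PathPlus-cong λ x → neighbours-reverse (pat x))

InFamily-reverse : ∀ {k} {pat : Fin k → Pattern} →
  InFamily (PathPlus k (neighbours ∘ reverse ∘ pat)) → InFamily (PathPlus k (neighbours ∘ pat))
InFamily-reverse {k} {pat} =
  InFamily-≅ {G = PathPlus k (neighbours ∘ pat)} {H = PathPlus k (neighbours ∘ reverse ∘ pat)}
    (PathPlus-pattern-reverse {pat = pat})

reverse-pairwise : ∀ {k} {pat : Fin k → Pattern} →
  PairwiseCompatible pat → PairwiseCompatible (reverse ∘ pat)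
reverse-pairwise pairwise x y = reverse-compatible ∘ pairwise x y

module _ {k : ℕ} {pat : Fin (suc k) → Pattern} (pairwise : PairwiseCompatible pat) where

  compatible-with-leading : ∀ {p} → pat 0F ≡ p → ∀ x → x ≢ 0F → Compatible p (pat x)
  compatible-with-leading refl x x≢0 = pairwise 0F x (x≢0 ∘ sym)

  constant-from-leading : ∀ {p} → pat 0F ≡ p → (∀ {q} → Compatible p q → q ≡ p) →
    ∀ x → pat x ≡ p
  constant-from-leading leading only x with x ≟ 0F
  ... | yes refl = leading
  ... | no x≢0   = only (compatible-with-leading leading x x≢0)

only-rt : ∀ {q} → Compatible rt q → q ≡ rt
only-rt rt-rt = refl

only-rstu : ∀ {q} → Compatible rstu q → q ≡ rstu
only-rstu rstu-rstu = refl

only-rtu : ∀ {q} → Compatible rsu q → q ≡ rtu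
only-rtu rsu-rtu = refl

ru-leading : ∀ {k} (pat : Fin (suc k) → Pattern) → PairwiseCompatible pat → pat 0F ≡ ru →
  InFamily (PathPlus (suc k) (neighbours ∘ pat))
ru-leading {zero}  pat _        leading =
  inj₁ (PathPlus-pattern-cong {pat = pat} {pat′ = λ _ → ru} λ { 0F → leading })
ru-leading {suc k} pat pairwise leading with () ← compatible-with-leading pairwise leading 1F (λ ())

rsu-leading : ∀ {k} (pat : Fin (suc k) → Pattern) → PairwiseCompatible pat → pat 0F ≡ rsu →
  InFamily (PathPlus (suc k) (neighbours ∘ pat))
rsu-leading {zero} pat _ leading =
  inj₂ (inj₁ (PathPlus-pattern-cong {pat = pat} {pat′ = λ _ → rsu} λ { 0F → leading }))
rsu-leading {suc zero} pat pairwise leading =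
  inj₂ (inj₂ (inj₁ (PathPlus-cong {M = family3nbr} λ where
    0F i → cong (λ p → neighbours p i) leading
    1F i → cong (λ p → neighbours p i) (only-rtu (compatible-with-leading pairwise leading 1F (λ ()))))))
-- both partners of rsu would be rtu, which is not compatible with itself
rsu-leading {suc (suc k)} pat pairwise leading
  with pat 1F | only-rtu (compatible-with-leading pairwise leading 1F (λ ()))
     | pat 2F | only-rtu (compatible-with-leading pairwise leading 2F (λ ()))
     | pairwise 1F 2F (λ ())
... | _ | refl | _ | refl | ()

rt-leading : ∀ {k} (pat : Fin (suc k) → Pattern) → PairwiseCompatible pat → pat 0F ≡ rt →
  InFamily (PathPlus (suc k) (neighbours ∘ pat))
rt-leading {k} pat pairwise leading = inj₂ (inj₂ (inj₂ (inj₁ (suc k ,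
  PathPlus-pattern-cong {pat = pat} {pat′ = λ _ → rt}
    (constant-from-leading pairwise leading only-rt)))))

rstu-leading : ∀ {k} (pat : Fin (suc k) → Pattern) → PairwiseCompatible pat → pat 0F ≡ rstu →
  InFamily (PathPlus (suc k) (neighbours ∘ pat))
rstu-leading {k} pat pairwise leading = inj₂ (inj₂ (inj₂ (inj₂ (suc k ,
  PathPlus-pattern-cong {pat = pat} {pat′ = λ _ → rstu}
    (constant-from-leading pairwise leading only-rstu)))))

compatible-family : ∀ k (pat : Fin k → Pattern) → PairwiseCompatible pat →
  InFamily (PathPlus k (neighbours ∘ pat))
compatible-family zero    pat _ =
  inj₂ (inj₂ (inj₂ (inj₁ (0 , PathPlus-cong {M = λ _ → neighbours rt} λ ()))))
compatible-family (suc k) pat pairwise with pat 0F in leading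
... | ru   = ru-leading pat pairwise leading
... | rsu  = rsu-leading pat pairwise leading
... | rt   = rt-leading pat pairwise leading
... | rstu = rstu-leading pat pairwise leading
... | rtu  = InFamily-reverse {pat = pat}
               (rsu-leading (reverse ∘ pat) (reverse-pairwise pairwise) (cong reverse leading))
... | su   = InFamily-reverse {pat = pat}
               (rt-leading (reverse ∘ pat) (reverse-pairwise pairwise) (cong reverse leading))

module Classification {n : ℕ} (G : Graph (Fin n)) (no-isolated : NoIsolated G)
  (critical : ¬ HasP4Contraction G) {a b c d : Fin n}
  (ab : Adj G a b) (bc : Adj G b c) (cd : Adj G c d)
  (¬ac : ¬ Adj G a c) (¬bd : ¬ Adj G b d) (¬ad : ¬ Adj G a d) where

  P : Fin 4 → Fin n
  P 0F = a
  P 1F = b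
  P 2F = c
  P 3F = d

  P-adj : ∀ i j → pathAdj i j ≡ adj G (P i) (P j)
  P-adj 0F 0F = sym (Graph.irrefl G a)
  P-adj 0F 1F = true≡ ab
  P-adj 0F 2F = false≡ ¬ac
  P-adj 0F 3F = false≡ ¬ad
  P-adj 1F 0F = true≡ (Adj-sym G ab)
  P-adj 1F 1F = sym (Graph.irrefl G b)
  P-adj 1F 2F = true≡ bc
  P-adj 1F 3F = false≡ ¬bd
  P-adj 2F 0F = false≡ (¬ac ∘ Adj-sym G)
  P-adj 2F 1F = true≡ (Adj-sym G bc)
  P-adj 2F 2F = sym (Graph.irrefl G c)
  P-adj 2F 3F = true≡ cd
  P-adj 3F 0F = false≡ (¬ad ∘ Adj-sym G)
  P-adj 3F 1F = false≡ (¬bd ∘ Adj-sym G)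
  P-adj 3F 2F = true≡ (Adj-sym G cd)
  P-adj 3F 3F = sym (Graph.irrefl G d)

  P-injective : Injective _≡_ _≡_ P
  P-injective {i} {j} Pi≡Pj = pathAdj-rows-injective i j λ k →
    trans (P-adj i k) (trans (cong (λ x → adj G x (P k)) Pi≡Pj) (sym (P-adj j k)))

  Outside : Fin n → Set
  Outside x = ∀ i → x ≢ P i

  -- contracting an edge outside P leaves P an induced P4
  outside-nonadjacent : ∀ {x y} → Outside x → Outside y → ¬ Adj G x y
  outside-nonadjacent {x} {y} out-x out-y xy =
    critical (x , y , xy , kept 0F , kept 1F , kept 2F , kept 3F , ab , bc , cd , ¬ac , ¬bd , ¬ad)
    where
    kept : Fin 4 → ContrV x y
    kept i = just (P i , out-x i ∘ sym , out-y i ∘ sym)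

  has-path-neighbour : ∀ x → Outside x → ∃ λ i → Adj G x (P i)
  has-path-neighbour x out with no-isolated x
  ... | w , xw with any? (λ i → w ≟ P i)
  ...   | yes (i , refl) = i , xw
  ...   | no w-out       = ⊥-elim (outside-nonadjacent out (λ i eq → w-out (i , eq)) xw)

  module _ {k : ℕ} (N : Fin k → Fin 4 → Bool) (e : Fin 4 ⊎ Fin k → Fin n)
    (e-path : ∀ i → e (inj₁ i) ≡ P i) (e-out : ∀ x → Outside (e (inj₂ x)))
    (e-trace : ∀ x i → N x i ≡ adj G (e (inj₂ x)) (P i)) where

    embedding-adj : AdjPreserving (PathPlus k N) G e
    embedding-adj = adj-preserving λ where
      (inj₁ i) (inj₁ j) → trans (P-adj i j) (sym (cong₂ (adj G) (e-path i) (e-path j)))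
      (inj₁ i) (inj₂ x) → trans (e-trace x i)
                            (trans (Graph.sym G _ _) (cong (λ z → adj G z _) (sym (e-path i))))
      (inj₂ x) (inj₁ i) → trans (e-trace x i) (cong (adj G _) (sym (e-path i)))
      (inj₂ x) (inj₂ y) → false≡ (outside-nonadjacent (e-out x) (e-out y))

  local-not-contractible : ∀ {k} (N : Fin k → Fin 4 → Bool) (ext : Fin k → Fin n) →
    Injective _≡_ _≡_ ext → (∀ x → Outside (ext x)) → (∀ x i → N x i ≡ adj G (ext x) (P i)) →
    ¬ HasP4Contraction (PathPlus k N)
  local-not-contractible N ext ext-injective ext-out ext-trace =
    critical ∘ map-HasP4Contraction
      (embedding-adj N [ P , ext ]′ (λ _ → refl) ext-out ext-trace) injective
    where
    injective : Injective _≡_ _≡_ [ P , ext ]′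
    injective {inj₁ i} {inj₁ j} eq = cong inj₁ (P-injective eq)
    injective {inj₁ i} {inj₂ y} eq = ⊥-elim (ext-out y i (sym eq))
    injective {inj₂ x} {inj₁ j} eq = ⊥-elim (ext-out x j eq)
    injective {inj₂ x} {inj₂ y} eq = cong inj₂ (ext-injective eq)

  Trace : Fin n → Set
  Trace x = Σ Pattern λ p → ∀ i → neighbours p i ≡ adj G x (P i)

  trace : ∀ x → Outside x → Trace x
  trace x out with classify-trace (adj G x a) (adj G x b) (adj G x c) (adj G x d)
  ... | inj₁ (p , p≡ν) = p , λ i → trans (cong-app p≡ν i) (nbr-η (adj G x ∘ P) i)
  ... | inj₂ (inj₁ empty) =
    let i , x~Pi = has-path-neighbour x out
    in ⊥-elim (subst T (trans (sym (nbr-η (adj G x ∘ P) i)) (empty i)) x~Pi)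
  ... | inj₂ (inj₂ contractible) = ⊥-elim
    (local-not-contractible _ (λ _ → x) (λ { {0F} {0F} _ → refl }) (λ _ → out)
      (λ _ → nbr-η (adj G x ∘ P)) contractible)

  compatible : ∀ {x y} → Outside x → Outside y → x ≢ y → (tx : Trace x) (ty : Trace y) →
    Compatible (proj₁ tx) (proj₁ ty)
  compatible {x} {y} out-x out-y x≢y (p , p-trace) (q , q-trace) with classify-traces p q
  ... | inj₁ p~q = p~q
  ... | inj₂ contractible =
    ⊥-elim (local-not-contractible (pairNeighbours p q) ext ext-injective ext-out ext-trace
      contractible)
    where
    ext : Fin 2 → Fin n
    ext 0F = x
    ext 1F = y
    ext-injective : Injective _≡_ _≡_ ext
    ext-injective {0F} {0F} _  = refl
    ext-injective {0F} {1F} eq = ⊥-elim (x≢y eq)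
    ext-injective {1F} {0F} eq = ⊥-elim (x≢y (sym eq))
    ext-injective {1F} {1F} _  = refl
    ext-out : ∀ z → Outside (ext z)
    ext-out 0F = out-x
    ext-out 1F = out-y
    ext-trace : ∀ z i → pairNeighbours p q z i ≡ adj G (ext z) (P i)
    ext-trace 0F = p-trace
    ext-trace 1F = q-trace

  decomposition : Σ ℕ λ k → Σ (Fin k → Pattern) λ pat →
    PairwiseCompatible pat × G ≅ PathPlus k (neighbours ∘ pat)
  decomposition with injection-complement P P-injective
  ... | k , φ , φ-path = k , pat , pairwise ,
    ≅-sym {G = PathPlus k (neighbours ∘ pat)} {H = G}
      (↔-sym φ , adj-≡ (embedding-adj (neighbours ∘ pat) from φ-path ext-out (proj₂ ∘ ext-trace)))
    where
    open Inverse φ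
    from-injective : Injective _≡_ _≡_ from
    from-injective = Injection.injective (↔⇒↣ (↔-sym φ))
    ext-out : ∀ x → Outside (from (inj₂ x))
    ext-out x i eq with () ← from-injective (trans eq (sym (φ-path i)))
    ext-trace : ∀ x → Trace (from (inj₂ x))
    ext-trace x = trace _ (ext-out x)
    pat : Fin k → Pattern
    pat = proj₁ ∘ ext-trace
    pairwise : PairwiseCompatible pat
    pairwise x y x≢y = compatible (ext-out x) (ext-out y) (x≢y ∘ inj₂-injective ∘ from-injective)
      (ext-trace x) (ext-trace y)

  classification : InFamily G
  classification =
    let k , pat , pairwise , G≅ = decomposition
    in InFamily-≅ {G = G} {H = PathPlus k (neighbours ∘ pat)} G≅ (compatible-family k pat pairwise)

proposition27 : (n : ℕ) (G : Graph (Fin n)) → NoIsolated G →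
    (CriticallyP4Exist G ⇔ InFamily G)
proposition27 n G no-isolated = mk⇔
  (λ ((_ , _ , _ , _ , ab , bc , cd , ¬ac , ¬bd , ¬ad) , critical) →
    Classification.classification G no-isolated (λ (u , v , e , q) → critical u v e q)
      ab bc cd ¬ac ¬bd ¬ad)
  (families-critical G)
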